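{- Let $G=(S,A,\downarrow,\to)$ be a labeled transition system and $B\subseteq A$. Let $\preceq_B$ be the partial bisimilarity preorder on $S$ and $\simeq_B=\preceq_B\cap\preceq_B^{ -1}$. Let $\mathcal P=S/\!\simeq_B$ and define $\sqsubseteq$ on $\mathcal P$ by $[p]_{\simeq_B}\sqsubseteq[q]_{\simeq_B}$ if and only if $p\preceq_B q$. Then $(\mathcal P,\sqsubseteq)$ is the $\lhd$-maximal partition-relation pair over $G$ that is stable with respect to $\downarrow$, $\to$ and $B$.
   Context: A labeled transition system $G=(S,A,\downarrow,\to)$ has state set $S$, action set $A$, termination predicate $\downarrow\subseteq S$ (write $p\downarrow$) and transition relation $\to\subseteq S\times A\times S$ (write $p\xrightarrow{a}q$). A relation $R\subseteq S\times S$ is a partial bisimulation w.r.t. $B$ if for all $(p,q)\in R$: (1) $p\downarrow$ implies $q\downarrow$; (2) if $p\xrightarrow{a}p'$ with $a\in A$ then $q\xrightarrow{a}q'$ for some $q'$ with $(p',q')\in R$; (3) if $q\xrightarrow{b}q'$ with $b\in B$ then $p\xrightarrow{b}p'$ for some $p'$ with $(p',q')\in R$. Partial bisimilarity: $p\preceq_B q$ iff $(p,q)\in R$ for some partial bisimulation $R$ w.r.t. $B$ (this is a preorder). A partition-relation pair is $(\mathcal P,\sqsubseteq)$ with $\mathcal P$ a partition of $S$ and $\sqsubseteq\subseteq\mathcal P\times\mathcal P$ a partial order. $(\mathcal P,\sqsubseteq)\lhd(\mathcal P',\sqsubseteq')$ iff for all $P,Q\in\mathcal P$ with $P\sqsubseteq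 Q$ there exist $P',Q'\in\mathcal P'$ with $P\subseteq P'$, $Q\subseteq Q'$, $P'\sqsubseteq'Q'$. For a class $P$ write $P\downarrow$ if all its states terminate, $P\not\downarrow$ if none does. For $P,X\subseteq S$: $P\xrightarrow{a}_\exists X$ means some $p\in P$ has $p\xrightarrow{a}x$ with $x\in X$; $P\xrightarrow{a}_\forall X$ means every $p\in P$ has some $x\in X$ with $p\xrightarrow{a}x$. $\mathrm{lb}(P)=\bigcup\{Q\in\mathcal P\mid Q\sqsubseteq P\}$, $\mathrm{bb}(P)=\bigcup\{Q\in\mathcal P\mid P\sqsubseteq Q\}$. $(\mathcal P,\sqsubseteq)$ is stable if: (a) every class $P$ has $P\downarrow$ or $P\not\downarrow$; (b) $P\sqsubseteq Q$ and $P\downarrow$ imply $Q\downarrow$; (c) for $P,Q,R\in\mathcal P$, $a\in A$: $P\sqsubseteq Q$ and $P\xrightarrow{a}_\exists R$ imply $Q\xrightarrow{a}_\forall\mathrm{bb}(R)$; (d) for $P,Q,R\in\mathcal P$, $b\in B$: $P\sqsubseteq Q$ and $Q\xrightarrow{b}_\exists R$ imply $P\xrightarrow{b}_\forall\mathrm{lb}(R)$. -}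

module Defs where

open import Level using (Level; 0ℓ; _⊔_) renaming (suc to lsuc)
open import Data.Product using (Σ; ∃; ∃₂; _×_; _,_)
open import Data.Sum using (_⊎_)
open import Relation.Nullary using (¬_)
open import Relation.Unary using (Pred; _⊆_)
open import Relation.Binary using (Rel; IsPartialOrder)

record LTS : Set₁ where
  field
    S    : Set
    A    : Set
    _↓   : Pred S 0ℓ
    _—[_]→_ : S → A → S → Set

module _ (G : LTS) where
  open LTS G

  IsPartialBisim : Pred A 0ℓ → Rel S 0ℓ → Set
  IsPartialBisim B R = ∀ {p q} → R p q →
      (p ↓ → q ↓)
    × (∀ {a p′} → p —[ a ]→ p′ → ∃ λ q′ → q —[ a ]→ q′ × R p′ q′)
    × (∀ {b q′} → B b → q —[ b ]→ q′ → ∃ λ p′ → p —[ b ]→ p′ × R p′ q′)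

  PBisim : Pred A 0ℓ → Rel S (lsuc 0ℓ)
  PBisim B p q = Σ (Rel S 0ℓ) λ R → IsPartialBisim B R × R p q

  PBisimEq : Pred A 0ℓ → Rel S (lsuc 0ℓ)
  PBisimEq B p q = PBisim B p q × PBisim B q p

  -- A partition-relation pair (𝒫, ⊑): the partition 𝒫 is represented by
  -- the equivalence relation _≈_ on S whose classes are the blocks of 𝒫;
  -- a partial order ⊑ on 𝒫 is represented by a relation on S that is a
  -- partial order with respect to _≈_ (so [p] ⊑ [q] iff p ⊑ q).
  record PRPair (ℓ : Level) : Set (lsuc ℓ) where
    field
      _≈_   : Rel S ℓ
      _⊑_   : Rel S ℓ
      isPartialOrder : IsPartialOrder _≈_ _⊑_

  module _ {ℓ : Level} (_≈_ : Rel S ℓ) (_⊑_ : Rel S ℓ) where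

    class : S → Pred S ℓ
    class p x = x ≈ p

    AllTerm : S → Set ℓ
    AllTerm p = ∀ x → x ≈ p → x ↓

    NoneTerm : S → Set ℓ
    NoneTerm p = ∀ x → x ≈ p → ¬ (x ↓)

    lb : S → Pred S ℓ
    lb r y = ∃ λ z → z ⊑ r × y ≈ z

    bb : S → Pred S ℓ
    bb r y = ∃ λ z → r ⊑ z × y ≈ z

  _—[_]→∃_ : ∀ {ℓ₁ ℓ₂} → Pred S ℓ₁ → A → Pred S ℓ₂ → Set (ℓ₁ ⊔ ℓ₂)
  P —[ a ]→∃ X = ∃ λ p → P p × ∃ λ x → X x × p —[ a ]→ x

  _—[_]→∀_ : ∀ {ℓ₁ ℓ₂} → Pred S ℓ₁ → A → Pred S ℓ₂ → Set (ℓ₁ ⊔ ℓ₂)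
  P —[ a ]→∀ X = ∀ p → P p → ∃ λ x → X x × p —[ a ]→ x

  -- stability of (𝒫, ⊑) w.r.t. ↓, → and B; classes are quantified via
  -- representatives p, q, r.
  Stable : ∀ {ℓ} → Pred A 0ℓ → Rel S ℓ → Rel S ℓ → Set ℓ
  Stable B _≈_ _⊑_ =
      (∀ p → AllTerm _≈_ _⊑_ p ⊎ NoneTerm _≈_ _⊑_ p)
    × (∀ p q → p ⊑ q → AllTerm _≈_ _⊑_ p → AllTerm _≈_ _⊑_ q)
    × (∀ p q r a → p ⊑ q → class _≈_ _⊑_ p —[ a ]→∃ class _≈_ _⊑_ r
         → class _≈_ _⊑_ q —[ a ]→∀ bb _≈_ _⊑_ r)
    × (∀ p q r b → B b → p ⊑ q → class _≈_ _⊑_ q —[ b ]→∃ class _≈_ _⊑_ r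
         → class _≈_ _⊑_ p —[ b ]→∀ lb _≈_ _⊑_ r)

  _◁_ : ∀ {ℓ₁ ℓ₂} → Rel S ℓ₁ × Rel S ℓ₁ → Rel S ℓ₂ × Rel S ℓ₂ → Set (ℓ₁ ⊔ ℓ₂)
  (_≈_ , _⊑_) ◁ (_≈′_ , _⊑′_) = ∀ p q → p ⊑ q → ∃₂ λ p′ q′ →
      (class _≈_ _⊑_ p ⊆ class _≈′_ _⊑′_ p′)
    × (class _≈_ _⊑_ q ⊆ class _≈′_ _⊑′_ q′)
    × p′ ⊑′ q′

  relsOf : ∀ {ℓ} → PRPair ℓ → Rel S ℓ × Rel S ℓ
  relsOf P = PRPair._≈_ P , PRPair._⊑_ P

-- Partial bisimulations contain the identity and are closed under composition,
-- so ≾ is a preorder and ≃ its kernel. Stability of (≃, ≾) is ≾ being itself a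
-- partial bisimulation, read blockwise. Conversely, the order ⊑ of any stable
-- pair is a partial bisimulation, so ⊑ ⊆ ≾ and ≈ ⊆ ≃, which is ◁-maximality.
module Submission where

open import Defs
open import Level using (0ℓ) renaming (suc to lsuc)
open import Data.Empty using (⊥-elim)
open import Data.Product using (_×_; _,_; ∃; proj₁; proj₂)
open import Data.Sum using (_⊎_; inj₁; inj₂)
open import Relation.Nullary using (yes; no)
open import Relation.Unary using (Pred)
open import Relation.Binary using (Rel; _⇒_; IsPreorder; IsPartialOrder)
open import Relation.Binary.PropositionalEquality using (_≡_; refl)
open import Axiom.ExcludedMiddle using (ExcludedMiddle)

module _ (G : LTS) where
  open LTS G

  ◁-⊆ : ∀ {ℓ₁ ℓ₂} {_≈_ _⊑_ : Rel S ℓ₁} {_≈′_ _⊑′_ : Rel S ℓ₂} →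
        _≈_ ⇒ _≈′_ → _⊑_ ⇒ _⊑′_ → _◁_ G (_≈_ , _⊑_) (_≈′_ , _⊑′_)
  ◁-⊆ ≈⇒≈′ ⊑⇒⊑′ p q p⊑q = p , q , ≈⇒≈′ , ≈⇒≈′ , ⊑⇒⊑′ p⊑q

  module _ (B : Pred A 0ℓ) where

    ≡-isPartialBisim : IsPartialBisim G B _≡_
    ≡-isPartialBisim refl =
        (λ p↓ → p↓)
      , (λ {_} {p′} p→p′ → p′ , p→p′ , refl)
      , (λ {_} {q′} _ q→q′ → q′ , q→q′ , refl)

    composite-isPartialBisim : ∀ {R R′ : Rel S 0ℓ} →
      IsPartialBisim G B R → IsPartialBisim G B R′ →
      IsPartialBisim G B (λ p q → ∃ λ m → R p m × R′ m q)
    composite-isPartialBisim isR isR′ (m , pRm , mR′q)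
      with isR pRm | isR′ mR′q
    ... | term , forth , back | term′ , forth′ , back′ =
        (λ p↓ → term′ (term p↓))
      , (λ p→p′ → let m′ , m→m′ , p′Rm′ = forth p→p′
                      q′ , q→q′ , m′R′q′ = forth′ m→m′
                  in q′ , q→q′ , (m′ , p′Rm′ , m′R′q′))
      , (λ b∈B q→q′ → let m′ , m→m′ , m′R′q′ = back′ b∈B q→q′
                          p′ , p→p′ , p′Rm′ = back b∈B m→m′
                      in p′ , p→p′ , (m′ , p′Rm′ , m′R′q′))

    ≾ : Rel S (lsuc 0ℓ)
    ≾ = PBisim G B

    ≃ : Rel S (lsuc 0ℓ)
    ≃ = PBisimEq G B

    ≾-refl : ∀ {p} → ≾ p p
    ≾-refl = _≡_ , ≡-isPartialBisim , refl

    ≾-trans : ∀ {p q r} → ≾ p q → ≾ q r → ≾ p r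
    ≾-trans (R , isR , pRq) (R′ , isR′ , qR′r) =
      _ , composite-isPartialBisim isR isR′ , (_ , pRq , qR′r)

    ≃-refl : ∀ {p} → ≃ p p
    ≃-refl = ≾-refl , ≾-refl

    ≾-isPartialOrder : IsPartialOrder ≃ ≾
    ≾-isPartialOrder = record
      { isPreorder = record
        { isEquivalence = record
          { refl  = ≃-refl
          ; sym   = λ (p≾q , q≾p) → q≾p , p≾q
          ; trans = λ (p≾q , q≾p) (q≾r , r≾q) → ≾-trans p≾q q≾r , ≾-trans r≾q q≾p
          }
        ; reflexive = proj₁
        ; trans     = ≾-trans
        }
      ; antisym = _,_
      }

    ≾-↓ : ∀ {p q} → ≾ p q → p ↓ → q ↓
    ≾-↓ (R , isR , pRq) = proj₁ (isR pRq)

    ≾-forth : ∀ {p q a p′} → ≾ p q → p —[ a ]→ p′ →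
              ∃ λ q′ → q —[ a ]→ q′ × ≾ p′ q′
    ≾-forth (R , isR , pRq) p→p′ =
      let q′ , q→q′ , p′Rq′ = proj₁ (proj₂ (isR pRq)) p→p′
      in q′ , q→q′ , (R , isR , p′Rq′)

    ≾-back : ∀ {p q b q′} → B b → ≾ p q → q —[ b ]→ q′ →
             ∃ λ p′ → p —[ b ]→ p′ × ≾ p′ q′
    ≾-back b∈B (R , isR , pRq) q→q′ =
      let p′ , p→p′ , p′Rq′ = proj₂ (proj₂ (isR pRq)) b∈B q→q′
      in p′ , p→p′ , (R , isR , p′Rq′)

    -- Excluded middle is needed only for clause (a): a ≃-class terminates
    -- as a whole or not at all, according to whether its representative does.
    ≾-stable : ExcludedMiddle 0ℓ → Stable G B ≃ ≾
    ≾-stable em = uniform , upward , forth , back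
      where
      uniform : ∀ p → AllTerm G ≃ ≾ p ⊎ NoneTerm G ≃ ≾ p
      uniform p with em {p ↓}
      ... | yes p↓ = inj₁ λ _ (_ , p≾x) → ≾-↓ p≾x p↓
      ... | no p↓̸  = inj₂ λ _ (x≾p , _) x↓ → p↓̸ (≾-↓ x≾p x↓)

      upward : ∀ p q → ≾ p q → AllTerm G ≃ ≾ p → AllTerm G ≃ ≾ q
      upward p q p≾q all↓ _ (_ , q≾x) = ≾-↓ (≾-trans p≾q q≾x) (all↓ p ≃-refl)

      forth : ∀ p q r a → ≾ p q → _—[_]→∃_ G (class G ≃ ≾ p) a (class G ≃ ≾ r) →
              _—[_]→∀_ G (class G ≃ ≾ q) a (bb G ≃ ≾ r)
      forth p q r a p≾q (p₀ , (p₀≾p , _) , x , (_ , r≾x) , p₀→x) q₀ (_ , q≾q₀) =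
        let y , q₀→y , x≾y = ≾-forth (≾-trans p₀≾p (≾-trans p≾q q≾q₀)) p₀→x
        in y , (y , ≾-trans r≾x x≾y , ≃-refl) , q₀→y

      back : ∀ p q r b → B b → ≾ p q → _—[_]→∃_ G (class G ≃ ≾ q) b (class G ≃ ≾ r) →
             _—[_]→∀_ G (class G ≃ ≾ p) b (lb G ≃ ≾ r)
      back p q r b b∈B p≾q (q₀ , (_ , q≾q₀) , x , (x≾r , _) , q₀→x) p₀ (p₀≾p , _) =
        let y , p₀→y , y≾x = ≾-back b∈B (≾-trans p₀≾p (≾-trans p≾q q≾q₀)) q₀→x
        in y , (y , ≾-trans y≾x x≾r , ≃-refl) , p₀→y

    -- Clauses (c) and (d), applied to singleton witnesses, are the transfer
    -- conditions of a partial bisimulation up to ≈, which ⊑ absorbs.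
    stable⇒isPartialBisim : ∀ {_≈_ _⊑_ : Rel S 0ℓ} → IsPreorder _≈_ _⊑_ →
                            Stable G B _≈_ _⊑_ → IsPartialBisim G B _⊑_
    stable⇒isPartialBisim isPreorder (uniform , upward , forth , back) {p} {q} p⊑q =
        term
      , (λ {a} {p′} p→p′ →
           let q′ , (z , p′⊑z , q′≈z) , q→q′ =
                 forth p q p′ a p⊑q (p , Eq.refl , p′ , Eq.refl , p→p′) q Eq.refl
           in q′ , q→q′ , ⊑-trans p′⊑z (⊑-reflexive (Eq.sym q′≈z)))
      , (λ {b} {q′} b∈B q→q′ →
           let p′ , (z , z⊑q′ , p′≈z) , p→p′ =
                 back p q q′ b b∈B p⊑q (q , Eq.refl , q′ , Eq.refl , q→q′) p Eq.refl
           in p′ , p→p′ , ⊑-trans (⊑-reflexive p′≈z) z⊑q′)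
      where
      open IsPreorder isPreorder using (module Eq)
        renaming (reflexive to ⊑-reflexive; trans to ⊑-trans)

      term : p ↓ → q ↓
      term p↓ with uniform p
      ... | inj₁ all↓  = upward p q p⊑q all↓ q Eq.refl
      ... | inj₂ none↓ = ⊥-elim (none↓ p Eq.refl p↓)

    stable⇒◁ : (P : PRPair G 0ℓ) → Stable G B (PRPair._≈_ P) (PRPair._⊑_ P) →
               _◁_ G (relsOf G P) (≃ , ≾)
    stable⇒◁ P stable = ◁-⊆ ≈⇒≃ ⊑⇒≾
      where
      open PRPair P
      open IsPartialOrder isPartialOrder using (isPreorder; module Eq)
        renaming (reflexive to ⊑-reflexive)

      ⊑⇒≾ : _⊑_ ⇒ ≾
      ⊑⇒≾ p⊑q = _⊑_ , stable⇒isPartialBisim isPreorder stable , p⊑q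

      ≈⇒≃ : _≈_ ⇒ ≃
      ≈⇒≃ x≈y = ⊑⇒≾ (⊑-reflexive x≈y) , ⊑⇒≾ (⊑-reflexive (Eq.sym x≈y))

theorem6 : ExcludedMiddle 0ℓ → (G : LTS) → (B : Pred (LTS.A G) 0ℓ) →
    IsPartialOrder (PBisimEq G B) (PBisim G B)
  × Stable G B (PBisimEq G B) (PBisim G B)
  × ((P : PRPair G 0ℓ) → Stable G B (PRPair._≈_ P) (PRPair._⊑_ P) →
       _◁_ G (relsOf G P) (PBisimEq G B , PBisim G B))
theorem6 em G B = ≾-isPartialOrder G B , ≾-stable G B em , stable⇒◁ G B
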